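{- Let $\pi=\pi_1\pi_2\cdots\pi_n\in S_n$ be a permutation with exactly $k$ descents. The map $\varphi\colon\mathcal H_{\{0,2\}}(\pi)\to \mathrm{Comp}_{k+1}(n-k)$ defined by $\varphi(\mathscr H)=(\widehat q_0(\mathscr H),\widehat q_1(\mathscr H),\ldots,\widehat q_k(\mathscr H))$ is injective.
   Context: $S_n$ is the set of permutations of $[n]=\{1,\ldots,n\}$. A descent of $\pi$ is an index $i\in[n-1]$ with $\pi_i>\pi_{i+1}$. $\mathrm{Comp}_a(b)$ denotes the set of compositions of $b$ into $a$ positive parts. Hooks: plot the points $(i,\pi_i)$. For indices $i<j$ with $\pi_i<\pi_j$, the hook $H$ from $(i,\pi_i)$ to $(j,\pi_j)$ is the union of the vertical segment from $(i,\pi_i)$ to $(i,\pi_j)$ and the horizontal segment from $(i,\pi_j)$ to $(j,\pi_j)$; its southwest endpoint is ${}_eH=(i,\pi_i)$ and its northeast endpoint is $H^e=(j,\pi_j)$. Its top part is the segment from $(i+1/2,\pi_j)$ to $(j,\pi_j)$. A valid hook configuration of $\pi$ is a tuple $\mathscr H=(H_1,\ldots,H_m)$ of hooks such that: (a) if ${}_eH_\ell=(i_\ell,\pi_{i_\ell})$ then $i_1<i_2<\cdots<i_m$; (b) for every descent $i$ of $\pi$, $(i,\pi_i)={}_eH_\ell$ for some $\ell$; (c) if $(j,\pi_j)=H_\ell^e$ for some $\ell$, then there are $\ell',\ell''$ such that the $x$-coordinate of ${}_eH_{\ell'}$ is a descent of $\pi$, $(j-1,\pi_{j-1})={}_eH_{\ell''}$,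 and $H_{\ell'}^e=H_{\ell''}^e=(j,\pi_j)$; (d) if ${}_eH_\ell=(i,\pi_i)$, $H_\ell^e=(j,\pi_j)$, ${}_eH_{\ell'}=(i',\pi_{i'})$, $H_{\ell'}^e=(j',\pi_{j'})$, $\pi_j\le\pi_{j'}$ and $|[i,j]\cap[i',j']|>1$, then $[i,j]\subseteq[i',j']$. Let $NE(\mathscr H)=\{H_1^e,\ldots,H_m^e\}$ and $|\mathscr H|=m$. $\mathcal H_{\{0,2\}}(\pi)$ is the set of valid hook configurations in which every point of $NE(\mathscr H)$ is the northeast endpoint of exactly two hooks. Coloring: given $\mathscr H=(H_1,\ldots,H_m)$, give $H_\ell$ color $c_\ell$. Color each point $(r,\pi_r)$ as follows: if $(r,\pi_r)\in NE(\mathscr H)$, give it color $c_t$ where $t$ is the largest index with $H_t^e=(r,\pi_r)$. Otherwise move directly upward from $(r,\pi_r)$ (ignoring any hook whose southwest endpoint is $(r,\pi_r)$) until first hitting the top part of a hook, and give the point the color of that hook; if several hooks are hit at once, use the one whose southwest endpoint is farthest right; if no top part is hit, use color $c_0$. Let $q_t(\mathscr H)$ be the number of points colored $c_t$. Let $\Theta(\mathscr H)$ be the set of $i\in\{0,1,\ldots,m\}$ such that $c_i$ is not the color of any point of $NE(\mathscr H)$. For $\mathscr H\in\mathcal H_{\{0,2\}}(\pi)$ one has $|\mathscr H|=2k$, $|NE(\mathscr H)|=k$ and $|\Theta(\mathscr H)|=k+1$; writing $\Theta(\mathscr H)=\{i_0<i_1<\cdots<i_k\}$, set $\widehat q_t(\mathscr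 H)=q_{i_t}(\mathscr H)$. Then $(\widehat q_0(\mathscr H),\ldots,\widehat q_k(\mathscr H))\in\mathrm{Comp}_{k+1}(n-k)$. -}

module Defs where

open import Data.Nat using (ℕ; zero; suc; _≤_; _<_; _∸_; _≡ᵇ_; _<ᵇ_; _≤ᵇ_; _⊔_; _⊓_)
open import Data.Nat.Properties using (_<?_)
open import Data.Bool using (Bool; true; false; _∧_; _∨_; not; if_then_else_)
open import Data.Product using (_×_; _,_; proj₁; proj₂; ∃-syntax)
open import Data.Maybe using (Maybe; just; nothing)
open import Data.List using (List; []; _∷_; length; map; upTo; filter; filterᵇ; zip; foldl; foldr)
open import Data.Bool.ListAction using (any)
open import Data.List.Relation.Unary.Linked using (Linked)
open import Data.List.Relation.Unary.Any using (Any)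
open import Data.List.Membership.Propositional using (_∈_)
open import Data.List.Relation.Binary.Permutation.Propositional using (_↭_)
open import Relation.Binary.PropositionalEquality using (_≡_)

range1 : ℕ → List ℕ
range1 n = map suc (upTo n)

IsPerm : ℕ → List ℕ → Set
IsPerm n π = π ↭ range1 n

-- 1-based access: at π i = πᵢ (for 1 ≤ i ≤ length π; junk value 0 otherwise)
at : List ℕ → ℕ → ℕ
at []       _             = 0
at (x ∷ xs) zero          = 0
at (x ∷ xs) (suc zero)    = x
at (x ∷ xs) (suc (suc i)) = at xs (suc i)

IsDescent : List ℕ → ℕ → Set
IsDescent π i = (1 ≤ i) × (suc i ≤ length π) × (at π (suc i) < at π i)

descents : List ℕ → List ℕ
descents π = filter (λ i → at π (suc i) <? at π i) (range1 (length π ∸ 1))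

-- Hooks.  A hook from (i,πᵢ) to (j,πⱼ) is recorded by the pair (i , j)
-- of its south-west and north-east x-coordinates.

Hook : Set
Hook = ℕ × ℕ

sw ne : Hook → ℕ
sw = proj₁
ne = proj₂

IsHook : List ℕ → Hook → Set
IsHook π (i , j) = (1 ≤ i) × (i < j) × (j ≤ length π) × (at π i < at π j)

HookConfig : Set
HookConfig = List Hook

-- number of integers in [i,j] ∩ [i',j']
overlapSize : Hook → Hook → ℕ
overlapSize (i , j) (i' , j') = suc (j ⊓ j') ∸ (i ⊔ i')

IsNE : HookConfig → ℕ → Set
IsNE ℋ r = Any (λ h → ne h ≡ r) ℋ

record ValidHookConfig (π : List ℕ) (ℋ : HookConfig) : Set where
  field
    hooks : ∀ h → h ∈ ℋ → IsHook π h
    condA : Linked (λ h h' → sw h < sw h') ℋ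
    condB : ∀ i → IsDescent π i → Any (λ h → sw h ≡ i) ℋ
    condC : ∀ j → IsNE ℋ j →
              (∃[ h' ] (h' ∈ ℋ × IsDescent π (sw h') × ne h' ≡ j))
              × (∃[ h'' ] (h'' ∈ ℋ × sw h'' ≡ j ∸ 1 × ne h'' ≡ j))
    condD : ∀ h h' → h ∈ ℋ → h' ∈ ℋ →
              at π (ne h) < at π (ne h') → 1 < overlapSize h h' →
              (sw h' ≤ sw h) × (ne h ≤ ne h')

neCount : HookConfig → ℕ → ℕ
neCount ℋ r = length (filterᵇ (λ h → ne h ≡ᵇ r) ℋ)

record InH02 (π : List ℕ) (ℋ : HookConfig) : Set where
  field
    valid   : ValidHookConfig π ℋ
    exactly2 : ∀ r → IsNE ℋ r → neCount ℋ r ≡ 2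

-- Coloring.  Hook Hₗ (ℓ = 1,…,m) gets color cₗ, recorded as the number ℓ;
-- color c₀ is recorded as 0.

indexed : HookConfig → List (ℕ × Hook)
indexed ℋ = zip (range1 (length ℋ)) ℋ

-- The top part is the segment from (i+1/2,πⱼ) to (j,πⱼ); it lies
-- strictly above (r,π_r) on the vertical line x = r iff i < r ≤ j and π_r < πⱼ.
hitsᵇ : List ℕ → ℕ → Hook → Bool
hitsᵇ π r (i , j) = (i <ᵇ r) ∧ (r ≤ᵇ j) ∧ (at π r <ᵇ at π j)

-- among two hit hooks, the one hit first (lower top part; on a tie the one
-- whose south-west endpoint is farthest to the right)
betterᵇ : List ℕ → (ℕ × Hook) → (ℕ × Hook) → Bool
betterᵇ π (_ , (i , j)) (_ , (i' , j')) =
  (at π j <ᵇ at π j') ∨ ((at π j ≡ᵇ at π j') ∧ (i' <ᵇ i))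

firstHit : List ℕ → List (ℕ × Hook) → Maybe (ℕ × Hook)
firstHit π = foldl step nothing
  where
    step : Maybe (ℕ × Hook) → (ℕ × Hook) → Maybe (ℕ × Hook)
    step nothing  c = just c
    step (just d) c = if betterᵇ π c d then just c else just d

color : List ℕ → HookConfig → ℕ → ℕ
color π ℋ r with filterᵇ (λ p → ne (proj₂ p) ≡ᵇ r) (indexed ℋ)
... | e ∷ es = foldr _⊔_ 0 (map proj₁ (e ∷ es))
... | []     with firstHit π (filterᵇ (λ p → hitsᵇ π r (proj₂ p)) (indexed ℋ))
...   | just (t , _) = t
...   | nothing      = 0

q : List ℕ → HookConfig → ℕ → ℕ
q π ℋ t = length (filterᵇ (λ r → color π ℋ r ≡ᵇ t) (range1 (length π)))

neColors : List ℕ → HookConfig → List ℕ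
neColors π ℋ =
  map (color π ℋ) (filterᵇ (λ r → any (λ h → ne h ≡ᵇ r) ℋ) (range1 (length π)))

Θ : List ℕ → HookConfig → List ℕ
Θ π ℋ = filterᵇ (λ t → not (any (λ c → c ≡ᵇ t) (neColors π ℋ))) (upTo (suc (length ℋ)))

φ : List ℕ → HookConfig → List ℕ
φ π ℋ = map (q π ℋ) (Θ π ℋ)

-- In ℋ ∈ 𝓗_{0,2}(π) every hook is long (it starts at a descent) or short
-- (from j ∸ 1 to j), and each north-east endpoint j ends exactly one long hook
-- and the short hook (j ∸ 1 , j).  The points of NE(ℋ) get colours of short
-- hooks, so Θ(ℋ) consists of c₀ and the colours of the long hooks, and φ(ℋ) is
-- q₀ followed by the sizes of the colour classes of the long hooks, ordered by
-- their descents.  Given φ(ℋ₁) ≡ φ(ℋ₂), the long hooks agree, by induction on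
-- the descents from the right: if at descent d they end at j₁ < j₂ and agree
-- further right, every point coloured by (d , j₁) in ℋ₁ is coloured by
-- (d , j₂) in ℋ₂, and so is j₁ itself, so the two classes differ in size.
-- The short hooks are then determined as well, and ℋ₁ ≡ ℋ₂ as sorted lists.
module Submission where

open import Defs
open import Data.Nat using (ℕ; zero; suc; _+_; _∸_; _≤_; _<_; _≡ᵇ_; _⊔_; _⊓_; z≤n; s≤s; s≤s⁻¹; z<s; s<s; _<?_; _≤?_; _≟_)
open import Data.Nat.Properties
open import Data.Bool using (true; false; T; not; if_then_else_)
open import Data.Bool.Properties using (T-∧; T-∨)
open import Data.Maybe using (just; nothing; maybe′)
open import Function.Bundles using (Equivalence)
open import Data.Empty using (⊥; ⊥-elim)
open import Data.Product using (∃-syntax; _×_; _,_; proj₁; proj₂)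
open import Data.Sum using (_⊎_; inj₁; inj₂)
open import Data.List using (List; []; _∷_; length; map; upTo; filter; filterᵇ; zip; foldr; applyUpTo)
open import Data.List.Relation.Unary.Any using (here; there; any?)
import Data.List.Relation.Unary.Any as Any
open import Data.List.Relation.Unary.Any.Properties using (any⁺; any⁻)
open import Data.Bool.ListAction using (any)
import Data.List.Relation.Unary.All as All
import Data.List.Relation.Unary.All.Properties as AllP
open import Data.List.Relation.Unary.AllPairs using (AllPairs; []; _∷_)
import Data.List.Relation.Unary.AllPairs as AllPairs
import Data.List.Relation.Unary.AllPairs.Properties as AllPairsP
open import Data.List.Membership.Propositional using (_∈_; lose; find)
open import Data.List.Relation.Unary.Linked.Properties using (Linked⇒AllPairs)
import Data.List.Properties as ListP
open ListP using (∷-injective)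
open import Data.List.Membership.Propositional.Properties using (∈-map⁺; ∈-map⁻; ∈-filter⁺; ∈-filter⁻; ∈-upTo⁺; ∈-upTo⁻)
open import Data.List.Relation.Binary.Permutation.Propositional using (↭-sym; ↭⇒↭ₛ)
import Data.List.Relation.Binary.Permutation.Setoid.Properties as PermS
open import Data.List.Relation.Binary.Subset.Propositional using (_⊆_)
open import Relation.Binary.PropositionalEquality
open import Relation.Nullary using (Dec; yes; no; ¬_)
open import Relation.Nullary.Decidable using (T?; _×-dec_)
open import Data.Product.Properties using (≡-dec; ×-≡,≡→≡)
open import Relation.Unary using (Decidable)
open import Relation.Binary.Definitions using (Asymmetric; tri<; tri≈; tri>)
open import Function using (_∘_; _$_)

module _ {A : Set} where

  minima-equal : ∀ {R : A → A → Set} → Asymmetric R → ∀ {x y xs ys} →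
                 All.All (R x) xs → All.All (R y) ys → x ∈ y ∷ ys → y ∈ x ∷ xs → x ≡ y
  minima-equal asym _ _ (here x≡y) _ = x≡y
  minima-equal asym _ _ (there _) (here y≡x) = sym y≡x
  minima-equal asym x< y< (there x∈) (there y∈) =
    ⊥-elim (asym (All.lookup x< y∈) (All.lookup y< x∈))

  sorted-unique : ∀ {R : A → A → Set} → Asymmetric R → ∀ {xs ys} →
                  AllPairs R xs → AllPairs R ys → xs ⊆ ys → ys ⊆ xs → xs ≡ ys
  sorted-unique asym {[]} {[]} _ _ _ _ = refl
  sorted-unique asym {[]} {y ∷ ys} _ _ _ ys⊆ with () ← ys⊆ (here refl)
  sorted-unique asym {x ∷ xs} {[]} _ _ xs⊆ _ with () ← xs⊆ (here refl)
  sorted-unique {R} asym {x ∷ xs} {y ∷ ys} (x< ∷ xs<) (y< ∷ ys<) xs⊆ ys⊆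
    with refl ← minima-equal asym x< y< (xs⊆ (here refl)) (ys⊆ (here refl)) =
    cong (x ∷_) (sorted-unique asym xs< ys< (tail x< (xs⊆ ∘ there)) (tail y< (ys⊆ ∘ there)))
    where
      tail : ∀ {zs ws} → All.All (R x) zs → zs ⊆ x ∷ ws → zs ⊆ ws
      tail x<zs zs⊆ z∈ with zs⊆ z∈
      ... | there z∈ws = z∈ws
      ... | here refl = ⊥-elim (asym r r) where r = All.lookup x<zs z∈

  sorted-trichotomy : ∀ {R : A → A → Set} {xs x y} → AllPairs R xs → x ∈ xs → y ∈ xs →
                      x ≡ y ⊎ R x y ⊎ R y x
  sorted-trichotomy (_ ∷ _) (here refl) (here refl) = inj₁ refl
  sorted-trichotomy (x< ∷ _) (here refl) (there y∈) = inj₂ (inj₁ (All.lookup x< y∈))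
  sorted-trichotomy (x< ∷ _) (there x∈) (here refl) = inj₂ (inj₂ (All.lookup x< x∈))
  sorted-trichotomy (_ ∷ xs<) (there x∈) (there y∈) = sorted-trichotomy xs< x∈ y∈

  two-members : ∀ {xs : List A} → length xs ≡ 2 → ∀ {a b c} → a ∈ xs → b ∈ xs → c ∈ xs →
                a ≢ b → a ≢ c → b ≢ c → ⊥
  two-members {_ ∷ _ ∷ []} refl (here refl) (here refl) _ a≢b _ _ = a≢b refl
  two-members {_ ∷ _ ∷ []} refl (there (here refl)) (there (here refl)) _ a≢b _ _ = a≢b refl
  two-members {_ ∷ _ ∷ []} refl (here refl) (there (here refl)) (here refl) _ a≢c _ = a≢c refl
  two-members {_ ∷ _ ∷ []} refl (here refl) (there (here refl)) (there (here refl)) _ _ b≢c = b≢c refl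
  two-members {_ ∷ _ ∷ []} refl (there (here refl)) (here refl) (here refl) _ _ b≢c = b≢c refl
  two-members {_ ∷ _ ∷ []} refl (there (here refl)) (here refl) (there (here refl)) _ a≢c _ = a≢c refl

  module _ {P Q : A → Set} (P? : Decidable P) (Q? : Decidable Q) where

    count-mono : ∀ xs → (∀ {x} → x ∈ xs → P x → Q x) →
                 length (filter P? xs) ≤ length (filter Q? xs)
    count-mono [] _ = z≤n
    count-mono (x ∷ xs) P⇒Q with P? x | Q? x
    ... | yes _ | yes _ = s≤s (count-mono xs (P⇒Q ∘ there))
    ... | yes p | no ¬q = ⊥-elim (¬q (P⇒Q (here refl) p))
    ... | no _  | yes _ = m≤n⇒m≤1+n (count-mono xs (P⇒Q ∘ there))
    ... | no _  | no _  = count-mono xs (P⇒Q ∘ there)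

    count-mono-< : ∀ xs → (∀ {x} → x ∈ xs → P x → Q x) → ∀ {w} → w ∈ xs → Q w → ¬ P w →
                   length (filter P? xs) < length (filter Q? xs)
    count-mono-< (x ∷ xs) P⇒Q w∈ qw ¬pw with P? x | Q? x | w∈
    ... | yes p | no ¬q | _ = ⊥-elim (¬q (P⇒Q (here refl) p))
    ... | yes p | yes _ | here refl = ⊥-elim (¬pw p)
    ... | no _  | no ¬q | here refl = ⊥-elim (¬q qw)
    ... | no _  | yes _ | here refl = s≤s (count-mono xs (P⇒Q ∘ there))
    ... | yes _ | yes _ | there w∈xs = s≤s (count-mono-< xs (P⇒Q ∘ there) w∈xs qw ¬pw)
    ... | no _  | yes _ | there w∈xs = m<n⇒m<1+n (count-mono-< xs (P⇒Q ∘ there) w∈xs qw ¬pw)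
    ... | no _  | no _  | there w∈xs = count-mono-< xs (P⇒Q ∘ there) w∈xs qw ¬pw

matched-by-key : ∀ {A B K V : Set} (key₁ : A → K) (key₂ : B → K) (val₁ : A → V) (val₂ : B → V)
                 {xs ys} → map key₁ xs ≡ map key₂ ys → map val₁ xs ≡ map val₂ ys →
                 AllPairs (λ a a' → key₁ a ≢ key₁ a') xs →
                 ∀ {a b} → a ∈ xs → b ∈ ys → key₁ a ≡ key₂ b → val₁ a ≡ val₂ b
matched-by-key key₁ key₂ val₁ val₂ {x ∷ xs} {y ∷ ys} keys vals (x≢ ∷ xs≢) a∈ b∈ k≡
  with ∷-injective keys | ∷-injective vals | a∈ | b∈
... | _ | v≡ , _ | here refl | here refl = v≡
... | _ , ks≡ | _ | here refl | there b∈ys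
  with a' , a'∈ , k≡' ← ∈-map⁻ key₁ (subst (key₂ _ ∈_) (sym ks≡) (∈-map⁺ key₂ b∈ys)) =
  ⊥-elim (All.lookup x≢ a'∈ (trans k≡ k≡'))
... | k₀≡ , _ | _ | there a∈xs | here refl =
  ⊥-elim (All.lookup x≢ a∈xs (trans k₀≡ (sym k≡)))
... | _ , ks≡ | _ , vs≡ | there a∈xs | there b∈ys =
  matched-by-key key₁ key₂ val₁ val₂ ks≡ vs≡ xs≢ a∈xs b∈ys k≡

max-upper : ∀ xs {y} → y ∈ xs → y ≤ foldr _⊔_ 0 xs
max-upper (x ∷ xs) (here refl) = m≤m⊔n x (foldr _⊔_ 0 xs)
max-upper (x ∷ xs) (there y∈) = ≤-trans (max-upper xs y∈) (m≤n⊔m x (foldr _⊔_ 0 xs))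

max-∈-cons : ∀ x xs → foldr _⊔_ 0 (x ∷ xs) ∈ x ∷ xs
max-∈-cons x [] = here (⊔-identityʳ x)
max-∈-cons x (y ∷ xs) with ⊔-sel x (foldr _⊔_ 0 (y ∷ xs))
... | inj₁ e = here e
... | inj₂ e = there (subst (_∈ y ∷ xs) (sym e) (max-∈-cons y xs))

max-∈ : ∀ xs {y} → y ∈ xs → foldr _⊔_ 0 xs ∈ xs
max-∈ (x ∷ xs) _ = max-∈-cons x xs

not-any⇒∉ : ∀ {t} cs → T (not (any (λ c → c ≡ᵇ t) cs)) → ¬ t ∈ cs
not-any⇒∉ {t} cs no-t t∈ with any (λ c → c ≡ᵇ t) cs in e
... | true = no-t
... | false = subst T e (any⁺ _ (Any.map (λ { refl → ≡⇒≡ᵇ t t refl }) t∈))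

∉⇒not-any : ∀ {t} cs → ¬ t ∈ cs → T (not (any (λ c → c ≡ᵇ t) cs))
∉⇒not-any {t} cs t∉ with any (λ c → c ≡ᵇ t) cs in e
... | false = _
... | true with c , c∈ , c≡ᵇt ← find (any⁻ _ cs (subst T (sym e) _)) =
  t∉ (subst (_∈ cs) (≡ᵇ⇒≡ c t c≡ᵇt) c∈)

module _ {A : Set} where

  labelled : (ℕ → ℕ) → List A → List (ℕ × A)
  labelled f [] = []
  labelled f (h ∷ hs) = (f 0 , h) ∷ labelled (f ∘ suc) hs

  zip-labelled : ∀ f (hs : List A) → zip (applyUpTo f (length hs)) hs ≡ labelled f hs
  zip-labelled f [] = refl
  zip-labelled f (h ∷ hs) = cong ((f 0 , h) ∷_) (zip-labelled (f ∘ suc) hs)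

  labelled-∈⁻ : ∀ f {t h} (hs : List A) → (t , h) ∈ labelled f hs →
                (∃[ i ] (i < length hs × t ≡ f i)) × h ∈ hs
  labelled-∈⁻ f (h ∷ hs) (here refl) = (0 , z<s , refl) , here refl
  labelled-∈⁻ f (h ∷ hs) (there th∈) with (i , i< , t≡) , h∈ ← labelled-∈⁻ (f ∘ suc) hs th∈ =
    (suc i , s<s i< , t≡) , there h∈

  labelled-∈⁺ : ∀ f {h} (hs : List A) → h ∈ hs → ∃[ t ] ((t , h) ∈ labelled f hs)
  labelled-∈⁺ f (h ∷ hs) (here refl) = f 0 , here refl
  labelled-∈⁺ f (h ∷ hs) (there h∈) with t , th∈ ← labelled-∈⁺ (f ∘ suc) hs h∈ = t , there th∈

  labelled-at : ∀ f (hs : List A) {i} → i < length hs → ∃[ h ] ((f i , h) ∈ labelled f hs)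
  labelled-at f (h ∷ hs) {zero} _ = h , here refl
  labelled-at f (h ∷ hs) {suc i} (s<s i<) with h' , th∈ ← labelled-at (f ∘ suc) hs i< = h' , there th∈

  labelled-sorted : ∀ f {R : A → A → Set} → (∀ {i j} → i < j → f i < f j) →
                    ∀ {hs} → AllPairs R hs →
                    AllPairs (λ a b → proj₁ a < proj₁ b × R (proj₂ a) (proj₂ b)) (labelled f hs)
  labelled-sorted f mono {[]} [] = []
  labelled-sorted f {R} mono {h ∷ hs} (h< ∷ hs<) =
    All.tabulate below ∷ labelled-sorted (f ∘ suc) (mono ∘ s<s) hs<
    where
      below : ∀ {b} → b ∈ labelled (f ∘ suc) hs → f 0 < proj₁ b × R h (proj₂ b)
      below b∈ with (i , _ , refl) , h'∈ ← labelled-∈⁻ (f ∘ suc) hs b∈ = mono z<s , All.lookup h< h'∈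

range1-∈⁺ : ∀ {n r} → 1 ≤ r → r ≤ n → r ∈ range1 n
range1-∈⁺ {r = suc r} _ r≤n = ∈-map⁺ suc (∈-upTo⁺ r≤n)

range1-∈⁻ : ∀ {n r} → r ∈ range1 n → 1 ≤ r × r ≤ n
range1-∈⁻ r∈ with i , i∈ , refl ← ∈-map⁻ suc r∈ = s≤s z≤n , ∈-upTo⁻ i∈

upTo-sorted : ∀ n → AllPairs _<_ (upTo n)
upTo-sorted n = AllPairsP.applyUpTo⁺₁ (λ i → i) n (λ i<j _ → i<j)

range1-sorted : ∀ n → AllPairs _<_ (range1 n)
range1-sorted n = AllPairsP.map⁺ (AllPairs.map s<s (upTo-sorted n))

at-∈ : ∀ xs {i} → 1 ≤ i → i ≤ length xs → at xs i ∈ xs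
at-∈ (x ∷ xs) {suc zero} _ _ = here refl
at-∈ (x ∷ xs) {suc (suc i)} _ (s≤s i≤) = there (at-∈ xs (s≤s z≤n) i≤)

AtInjective : List ℕ → Set
AtInjective π = ∀ {i j} → 1 ≤ i → i ≤ length π → 1 ≤ j → j ≤ length π → at π i ≡ at π j → i ≡ j

unique⇒at-injective : ∀ {xs} → AllPairs _≢_ xs → AtInjective xs
unique⇒at-injective {x ∷ xs} _ {suc zero} {suc zero} _ _ _ _ _ = refl
unique⇒at-injective {x ∷ xs} (x≢ ∷ _) {suc zero} {suc (suc j)} _ _ _ (s≤s j≤) e =
  ⊥-elim (All.lookup x≢ (at-∈ xs (s≤s z≤n) j≤) e)
unique⇒at-injective {x ∷ xs} (x≢ ∷ _) {suc (suc i)} {suc zero} _ (s≤s i≤) _ _ e =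
  ⊥-elim (All.lookup x≢ (at-∈ xs (s≤s z≤n) i≤) (sym e))
unique⇒at-injective {x ∷ xs} (_ ∷ xs≢) {suc (suc i)} {suc (suc j)} _ (s≤s i≤) _ (s≤s j≤) e =
  cong suc (unique⇒at-injective xs≢ (s≤s z≤n) i≤ (s≤s z≤n) j≤ e)

perm⇒at-injective : ∀ {n π} → IsPerm n π → AtInjective π
perm⇒at-injective {n} π↭ = unique⇒at-injective
  (PermS.Unique-resp-↭ (setoid ℕ) (↭⇒↭ₛ (↭-sym π↭)) (AllPairs.map <⇒≢ (range1-sorted n)))

descent? : ∀ π d → Dec (IsDescent π d)
descent? π d = 1 ≤? d ×-dec suc d ≤? length π ×-dec at π (suc d) <? at π d

descents-sorted : ∀ π → AllPairs _<_ (descents π)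
descents-sorted π = AllPairsP.filter⁺ _ (range1-sorted (length π ∸ 1))

∈-descents⁺ : ∀ {π d} → IsDescent π d → d ∈ descents π
∈-descents⁺ {π} {d} (1≤d , d<n , π↓) =
  ∈-filter⁺ (λ i → at π (suc i) <? at π i) (range1-∈⁺ 1≤d (below (length π) d<n)) π↓
  where
    below : ∀ n → suc d ≤ n → d ≤ n ∸ 1
    below (suc n) (s≤s d≤n) = d≤n

∈-descents⁻ : ∀ {π d} → d ∈ descents π → IsDescent π d
∈-descents⁻ {π} {d} d∈ =
  let d∈range , π↓ = ∈-filter⁻ (λ i → at π (suc i) <? at π i) d∈
      1≤d , d≤ = range1-∈⁻ d∈range
  in 1≤d , below (length π) 1≤d d≤ , π↓
  where
    below : ∀ n → 1 ≤ d → d ≤ n ∸ 1 → suc d ≤ n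
    below zero 1≤d d≤0 = ⊥-elim (<⇒≱ 1≤d d≤0)
    below (suc n) _ d≤n = s≤s d≤n

module HitOrder (π : List ℕ) where

  Hits : ℕ → Hook → Set
  Hits r h = sw h < r × r ≤ ne h × at π r < at π (ne h)

  HitBefore : Hook → Hook → Set
  HitBefore h h' = at π (ne h) < at π (ne h') ⊎ (at π (ne h) ≡ at π (ne h') × sw h' < sw h)

  hitsᵇ⇒Hits : ∀ r h → T (hitsᵇ π r h) → Hits r h
  hitsᵇ⇒Hits r (i , j) t with a , bc ← Equivalence.to T-∧ t with b , c ← Equivalence.to T-∧ bc =
    <ᵇ⇒< _ _ a , ≤ᵇ⇒≤ _ _ b , <ᵇ⇒< _ _ c

  Hits⇒hitsᵇ : ∀ r h → Hits r h → T (hitsᵇ π r h)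
  Hits⇒hitsᵇ r (i , j) (a , b , c) =
    Equivalence.from T-∧ (<⇒<ᵇ a , Equivalence.from T-∧ (≤⇒≤ᵇ b , <⇒<ᵇ c))

  betterᵇ⇒HitBefore : ∀ a b → T (betterᵇ π a b) → HitBefore (proj₂ a) (proj₂ b)
  betterᵇ⇒HitBefore (_ , (i , j)) (_ , (i' , j')) t with Equivalence.to T-∨ t
  ... | inj₁ lower = inj₁ (<ᵇ⇒< _ _ lower)
  ... | inj₂ tie with same , right ← Equivalence.to T-∧ tie = inj₂ (≡ᵇ⇒≡ _ _ same , <ᵇ⇒< _ _ right)

  HitBefore⇒betterᵇ : ∀ a b → HitBefore (proj₂ a) (proj₂ b) → T (betterᵇ π a b)
  HitBefore⇒betterᵇ (_ , (i , j)) (_ , (i' , j')) (inj₁ lower) =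
    Equivalence.from T-∨ (inj₁ (<⇒<ᵇ lower))
  HitBefore⇒betterᵇ (_ , (i , j)) (_ , (i' , j')) (inj₂ (same , right)) =
    Equivalence.from T-∨ (inj₂ (Equivalence.from T-∧ (≡⇒≡ᵇ _ _ same , <⇒<ᵇ right)))

  before-irrefl : ∀ h → ¬ HitBefore h h
  before-irrefl h (inj₁ x) = <-irrefl refl x
  before-irrefl h (inj₂ (_ , x)) = <-irrefl refl x

  before-trans : ∀ {a b c} → HitBefore a b → HitBefore b c → HitBefore a c
  before-trans (inj₁ x) (inj₁ y) = inj₁ (<-trans x y)
  before-trans (inj₁ x) (inj₂ (e , _)) = inj₁ (subst (_ <_) e x)
  before-trans (inj₂ (e , _)) (inj₁ y) = inj₁ (subst (_< _) (sym e) y)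
  before-trans (inj₂ (e , x)) (inj₂ (e' , y)) = inj₂ (trans e e' , <-trans y x)

  before-compare : ∀ h h' → HitBefore h h' ⊎ HitBefore h' h ⊎
                            (at π (ne h) ≡ at π (ne h') × sw h ≡ sw h')
  before-compare h h' with <-cmp (at π (ne h)) (at π (ne h'))
  ... | tri< lower _ _ = inj₁ (inj₁ lower)
  ... | tri> _ _ higher = inj₂ (inj₁ (inj₁ higher))
  ... | tri≈ _ same _ with <-cmp (sw h) (sw h')
  ...   | tri< left _ _ = inj₂ (inj₁ (inj₂ (sym same , left)))
  ...   | tri≈ _ e _ = inj₂ (inj₂ (same , e))
  ...   | tri> _ _ right = inj₁ (inj₂ (same , right))

  before-split : ∀ {y d c} → ¬ HitBefore d c → HitBefore y c → HitBefore y d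
  before-split {y} {d} {c} ¬d<c y<c with before-compare c d
  ... | inj₁ c<d = before-trans y<c c<d
  ... | inj₂ (inj₁ d<c) = ⊥-elim (¬d<c d<c)
  ... | inj₂ (inj₂ (same , e)) with y<c
  ...   | inj₁ lower = inj₁ (subst (_ <_) same lower)
  ...   | inj₂ (e' , right) = inj₂ (trans e' same , subst (_< _) e right)

  firstHit-unfold : ∀ d y ys → firstHit π (d ∷ y ∷ ys) ≡
                    (if betterᵇ π y d then firstHit π (y ∷ ys) else firstHit π (d ∷ ys))
  firstHit-unfold d y ys with betterᵇ π y d
  ... | true = refl
  ... | false = refl

  firstHit-cons : ∀ d ys {c} → firstHit π (d ∷ ys) ≡ just c →
                  c ∈ d ∷ ys × (∀ {e} → e ∈ d ∷ ys → ¬ HitBefore (proj₂ e) (proj₂ c))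
  firstHit-cons d [] refl = here refl , λ { (here refl) → before-irrefl _ }
  firstHit-cons d (y ∷ ys) {c} fh with betterᵇ π y d in y<ᵇd | trans (sym (firstHit-unfold d y ys)) fh
  ... | true | fh' with c∈ , minimal ← firstHit-cons y ys fh' = there c∈ , λ
      { (here refl) d<c → minimal (here refl) (before-trans y<d d<c)
      ; (there e∈) → minimal e∈ }
    where y<d = betterᵇ⇒HitBefore y d (subst T (sym y<ᵇd) _)
  ... | false | fh' with c∈ , minimal ← firstHit-cons d ys fh' = keep c∈ , λ
      { (here refl) → minimal (here refl)
      ; (there (here refl)) y<c → subst T y<ᵇd
          (HitBefore⇒betterᵇ y d (before-split (minimal (here refl)) y<c))
      ; (there (there e∈)) → minimal (there e∈) }
    where
      keep : ∀ {x} → x ∈ d ∷ ys → x ∈ d ∷ y ∷ ys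
      keep (here e) = here e
      keep (there x∈) = there (there x∈)

  firstHit-defined : ∀ d ys → firstHit π (d ∷ ys) ≢ nothing
  firstHit-defined d [] ()
  firstHit-defined d (y ∷ ys) e with betterᵇ π y d
  ... | true = firstHit-defined y ys e
  ... | false = firstHit-defined d ys e

  firstHit-just : ∀ L {c} → firstHit π L ≡ just c →
                  c ∈ L × (∀ {e} → e ∈ L → ¬ HitBefore (proj₂ e) (proj₂ c))
  firstHit-just (d ∷ ys) = firstHit-cons d ys

  firstHit-nothing : ∀ L → firstHit π L ≡ nothing → L ≡ []
  firstHit-nothing [] _ = refl
  firstHit-nothing (d ∷ ys) fh = ⊥-elim (firstHit-defined d ys fh)

overlap-two : ∀ {i i' j j' x} → i ≤ x → i' ≤ x → x < j → x < j' → 1 < overlapSize (i , j) (i' , j')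
overlap-two {i} {i'} {j} {j'} {x} i≤x i'≤x x<j x<j' = begin
  2                      ≡⟨ sym (m+n∸n≡m 2 x) ⟩
  2 + x ∸ x              ≤⟨ ∸-mono (s≤s (⊓-glb x<j x<j')) (⊔-lub i≤x i'≤x) ⟩
  suc (j ⊓ j') ∸ (i ⊔ i') ∎
  where open ≤-Reasoning

short-meets-end : ∀ {i j r} → i ≡ j ∸ 1 → i < r → r ≤ j → r ≡ j
short-meets-end {j = zero} refl i<r r≤0 = ⊥-elim (<⇒≱ i<r r≤0)
short-meets-end {j = suc j} refl i<r r≤j = ≤-antisym r≤j i<r

module Configuration (π : List ℕ) (at-inj : AtInjective π) {ℋ : HookConfig} (H : InH02 π ℋ) where
  open ValidHookConfig (InH02.valid H) public

  Long : Hook → Set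
  Long h = IsDescent π (sw h)

  sw-sorted : AllPairs (λ h h' → sw h < sw h') ℋ
  sw-sorted = Linked⇒AllPairs <-trans condA

  sw-injective : ∀ {h h'} → h ∈ ℋ → h' ∈ ℋ → sw h ≡ sw h' → h ≡ h'
  sw-injective h∈ h'∈ e with sorted-trichotomy sw-sorted h∈ h'∈
  ... | inj₁ h≡h' = h≡h'
  ... | inj₂ (inj₁ lt) = ⊥-elim (<-irrefl e lt)
  ... | inj₂ (inj₂ gt) = ⊥-elim (<-irrefl (sym e) gt)

  no-three : ∀ {a b c j} → a ∈ ℋ → b ∈ ℋ → c ∈ ℋ → ne a ≡ j → ne b ≡ j → ne c ≡ j →
             a ≢ b → a ≢ c → b ≢ c → ⊥
  no-three {j = j} a∈ b∈ c∈ ea eb ec =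
    two-members (InH02.exactly2 H j (lose a∈ ea)) (ending a∈ ea) (ending b∈ eb) (ending c∈ ec)
    where
      ending : ∀ {x} → x ∈ ℋ → ne x ≡ j → x ∈ filterᵇ (λ h → ne h ≡ᵇ j) ℋ
      ending x∈ e = ∈-filter⁺ (λ h → T? (ne h ≡ᵇ j)) x∈ (≡⇒≡ᵇ _ _ e)

  short-at : ∀ {j} → IsNE ℋ j → (j ∸ 1 , j) ∈ ℋ
  short-at j∈NE with h , h∈ , refl , refl ← proj₂ (condC _ j∈NE) = h∈

  long-at : ∀ {j} → IsNE ℋ j → ∃[ h ] (h ∈ ℋ × Long h × ne h ≡ j)
  long-at j∈NE = proj₁ (condC _ j∈NE)

  -- the short hook rises, so its south-west endpoint is not a descent
  short-not-long : ∀ {j} → (j ∸ 1 , j) ∈ ℋ → ¬ Long (j ∸ 1 , j)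
  short-not-long {suc j} s∈ (_ , _ , fall) = <-asym fall (proj₂ (proj₂ (proj₂ (hooks _ s∈))))
  short-not-long {zero} s∈ with () ← proj₁ (proj₂ (hooks _ s∈))

  long-or-short : ∀ {h} → h ∈ ℋ → Long h ⊎ sw h ≡ ne h ∸ 1
  long-or-short {h} h∈ with descent? π (sw h) | sw h ≟ ne h ∸ 1
  ... | yes long | _ = inj₁ long
  ... | no _ | yes short = inj₂ short
  ... | no ¬long | no ¬short with g , g∈ , g-long , g-ne ← long-at (lose h∈ refl) =
    ⊥-elim $ no-three h∈ g∈ (short-at (lose h∈ refl)) refl g-ne refl
      (λ h≡g → ¬long (subst Long (sym h≡g) g-long)) (λ h≡s → ¬short (cong sw h≡s))
      (λ g≡s → short-not-long (short-at (lose h∈ refl)) (subst Long g≡s g-long))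

  long-ne-injective : ∀ {h h'} → h ∈ ℋ → h' ∈ ℋ → Long h → Long h' → ne h ≡ ne h' → h ≡ h'
  long-ne-injective {h} {h'} h∈ h'∈ long long' e with ≡-dec _≟_ _≟_ h h'
  ... | yes h≡h' = h≡h'
  ... | no h≢h' = ⊥-elim (no-three h∈ h'∈ s∈ refl (sym e) refl h≢h'
                           (λ h≡s → short-not-long s∈ (subst Long h≡s long))
                           (λ h'≡s → short-not-long s∈ (subst Long h'≡s long')))
    where s∈ = short-at (lose h∈ refl)

  hook-at : ∀ {d} → IsDescent π d → ∃[ h ] (h ∈ ℋ × sw h ≡ d)
  hook-at d-desc = find (condB _ d-desc)

  long-before-short : ∀ {h} → h ∈ ℋ → Long h → sw h < ne h ∸ 1
  long-before-short {h} h∈ long = ≤∧≢⇒< sw≤ sw≢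
    where
      s∈ = short-at (lose h∈ refl)
      sw≤ : sw h ≤ ne h ∸ 1
      sw≤ = subst (sw h ≤_) (pred[m∸n]≡m∸[1+n] (ne h) 0) (<⇒≤pred (proj₁ (proj₂ (hooks _ h∈))))
      sw≢ : sw h ≢ ne h ∸ 1
      sw≢ e = short-not-long s∈ (subst Long (sw-injective h∈ s∈ e) long)

  ne-position : ∀ {h} → h ∈ ℋ → 1 ≤ ne h × ne h ≤ length π
  ne-position h∈ with 1≤i , i<j , j≤n , _ ← hooks _ h∈ = ≤-trans 1≤i (<⇒≤ i<j) , j≤n

  -- A descent d strictly inside a long hook h lies below its top: the hook g
  -- starting at d reaches above πd, and by condition (d) its top cannot lie
  -- above the top of h, nor at the same height (g would then be h).
  descent-below-long : ∀ {h d} → h ∈ ℋ → Long h → sw h < d → d < ne h → IsDescent π d →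
                       at π d < at π (ne h)
  descent-below-long {h} {d} h∈ long sw<d d<ne d-desc
    with g , g∈ , refl ← hook-at d-desc
    with _ , d<ne-g , _ , πd<πg ← hooks g g∈
    with <-cmp (at π (ne h)) (at π (ne g))
  ... | tri< πh<πg _ _ = ⊥-elim (<⇒≱ sw<d (proj₁ (condD h g h∈ g∈ πh<πg
                            (overlap-two (<⇒≤ sw<d) ≤-refl d<ne d<ne-g))))
  ... | tri> _ _ πg<πh = <-trans πd<πg πg<πh
  ... | tri≈ _ πh≡πg _ = ⊥-elim (<-irrefl (cong sw h≡g) sw<d)
    where
      h≡g : h ≡ g
      h≡g = long-ne-injective h∈ g∈ long d-desc
              (at-inj (proj₁ (ne-position h∈)) (proj₂ (ne-position h∈))
                      (proj₁ (ne-position g∈)) (proj₂ (ne-position g∈)) πh≡πg)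

  -- Walking
  -- left from the north-east endpoint j: the point j ∸ 1 starts the short
  -- hook to j, a rise keeps the point lower, and a descent is handled above.
  below-long-from : ∀ {h} → h ∈ ℋ → Long h → ∀ k {r} → sw h < r → r + suc k ≡ ne h →
                    at π r < at π (ne h)
  below-long-from {h} h∈ long zero {r} sw<r r+1≡ne =
    subst (λ x → at π x < at π (ne h)) (trans (cong (_∸ 1) (sym r+1≡ne)) (m+n∸n≡m r 1))
      (proj₂ (proj₂ (proj₂ (hooks _ (short-at (lose h∈ refl))))))
  below-long-from {h} h∈ long (suc k) {r} sw<r r+k+2≡ne with at π (suc r) <? at π r
  ... | yes fall = descent-below-long h∈ long sw<r r<ne
                     (≤-trans (proj₁ (hooks _ h∈)) (<⇒≤ sw<r) , ≤-trans r<ne (proj₂ (ne-position h∈)) , fall)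
    where r<ne = subst (r <_) r+k+2≡ne (m<m+n r z<s)
  ... | no rise = ≤-<-trans (≮⇒≥ rise)
                    (below-long-from h∈ long k (m<n⇒m<1+n sw<r) (trans (sym (+-suc r (suc k))) r+k+2≡ne))

  below-long : ∀ {h} → h ∈ ℋ → Long h → ∀ {r} → sw h < r → r < ne h → at π r < at π (ne h)
  below-long {h} h∈ long {r} sw<r r<ne =
    below-long-from h∈ long (ne h ∸ suc r) sw<r (trans (+-suc r _) (m+[n∸m]≡n r<ne))

module Coloring (π : List ℕ) (at-inj : AtInjective π) {ℋ : HookConfig} (H : InH02 π ℋ) where
  open Configuration π at-inj H public
  open HitOrder π public

  I : List (ℕ × Hook)
  I = indexed ℋ

  I≡labelled : I ≡ labelled suc ℋ
  I≡labelled = trans (cong (λ ts → zip ts ℋ) (ListP.map-upTo suc (length ℋ))) (zip-labelled suc ℋ)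

  I-sorted : AllPairs (λ a b → proj₁ a < proj₁ b × sw (proj₂ a) < sw (proj₂ b)) I
  I-sorted = subst (AllPairs _) (sym I≡labelled) (labelled-sorted suc s<s sw-sorted)

  I-∈⁻ : ∀ {t h} → (t , h) ∈ I → (∃[ i ] (i < length ℋ × t ≡ suc i)) × h ∈ ℋ
  I-∈⁻ th∈ = labelled-∈⁻ suc ℋ (subst (_ ∈_) I≡labelled th∈)

  hook-∈ : ∀ {t h} → (t , h) ∈ I → h ∈ ℋ
  hook-∈ = proj₂ ∘ I-∈⁻

  colour-positive : ∀ {t h} → (t , h) ∈ I → 1 ≤ t
  colour-positive th∈ with (_ , _ , refl) , _ ← I-∈⁻ th∈ = s≤s z≤n

  colour-of : ∀ {h} → h ∈ ℋ → ∃[ t ] ((t , h) ∈ I)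
  colour-of h∈ with t , th∈ ← labelled-∈⁺ suc ℋ h∈ = t , subst (_ ∈_) (sym I≡labelled) th∈

  hook-of-colour : ∀ {i} → i < length ℋ → ∃[ h ] ((suc i , h) ∈ I)
  hook-of-colour i< with h , th∈ ← labelled-at suc ℋ i< = h , subst (_ ∈_) (sym I≡labelled) th∈

  colour-mono : ∀ {t t' h h'} → (t , h) ∈ I → (t' , h') ∈ I → sw h < sw h' → t < t'
  colour-mono th∈ th'∈ sw< with sorted-trichotomy I-sorted th∈ th'∈
  ... | inj₁ refl = ⊥-elim (<-irrefl refl sw<)
  ... | inj₂ (inj₁ (t< , _)) = t<
  ... | inj₂ (inj₂ (_ , sw>)) = ⊥-elim (<-asym sw< sw>)

  same-colour : ∀ {t h h'} → (t , h) ∈ I → (t , h') ∈ I → h ≡ h'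
  same-colour th∈ th'∈ with sorted-trichotomy I-sorted th∈ th'∈
  ... | inj₁ refl = refl
  ... | inj₂ (inj₁ (t<t , _)) = ⊥-elim (<-irrefl refl t<t)
  ... | inj₂ (inj₂ (t<t , _)) = ⊥-elim (<-irrefl refl t<t)

  same-hook : ∀ {t t' h} → (t , h) ∈ I → (t' , h) ∈ I → t ≡ t'
  same-hook th∈ t'h∈ with sorted-trichotomy I-sorted th∈ t'h∈
  ... | inj₁ refl = refl
  ... | inj₂ (inj₁ (_ , sw<sw)) = ⊥-elim (<-irrefl refl sw<sw)
  ... | inj₂ (inj₂ (_ , sw<sw)) = ⊥-elim (<-irrefl refl sw<sw)

  ending : ℕ → List (ℕ × Hook)
  ending r = filterᵇ (λ p → ne (proj₂ p) ≡ᵇ r) I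

  hit : ℕ → List (ℕ × Hook)
  hit r = filterᵇ (λ p → hitsᵇ π r (proj₂ p)) I

  ending-∈⁺ : ∀ {t h} → (t , h) ∈ I → (t , h) ∈ ending (ne h)
  ending-∈⁺ {h = h} th∈ = ∈-filter⁺ (λ p → T? (ne (proj₂ p) ≡ᵇ ne h)) th∈ (≡⇒≡ᵇ (ne h) (ne h) refl)

  ending-∈⁻ : ∀ {r p} → p ∈ ending r → p ∈ I × ne (proj₂ p) ≡ r
  ending-∈⁻ {r} p∈ with p∈I , e ← ∈-filter⁻ (λ p → T? (ne (proj₂ p) ≡ᵇ r)) p∈ = p∈I , ≡ᵇ⇒≡ _ _ e

  hit-∈⁺ : ∀ {r t h} → (t , h) ∈ I → Hits r h → (t , h) ∈ hit r
  hit-∈⁺ {r} th∈ hits = ∈-filter⁺ (λ p → T? (hitsᵇ π r (proj₂ p))) th∈ (Hits⇒hitsᵇ r _ hits)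

  hit-∈⁻ : ∀ {r t h} → (t , h) ∈ hit r → (t , h) ∈ I × Hits r h
  hit-∈⁻ {r} th∈ with th∈I , hits ← ∈-filter⁻ (λ p → T? (hitsᵇ π r (proj₂ p))) th∈ =
    th∈I , hitsᵇ⇒Hits r _ hits

  hit-colour : ℕ → ℕ
  hit-colour r = maybe′ proj₁ 0 (firstHit π (hit r))

  hit-colour-just : ∀ {r c} → firstHit π (hit r) ≡ just c → hit-colour r ≡ proj₁ c
  hit-colour-just fh rewrite fh = refl

  hit-colour-nothing : ∀ {r} → firstHit π (hit r) ≡ nothing → hit-colour r ≡ 0
  hit-colour-nothing fh rewrite fh = refl

  colour-on-NE : ∀ {r} → IsNE ℋ r → color π ℋ r ≡ foldr _⊔_ 0 (map proj₁ (ending r))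
  colour-on-NE {r} r∈NE with ending r in eq
  ... | _ ∷ _ = refl
  ... | [] with h , h∈ , refl ← find r∈NE
             with t , th∈ ← colour-of h∈
             with () ← subst ((t , h) ∈_) eq (ending-∈⁺ th∈)

  colour-off-NE : ∀ {r} → ¬ IsNE ℋ r → color π ℋ r ≡ hit-colour r
  colour-off-NE {r} r∉NE with ending r in eq
  ... | p ∷ _ = ⊥-elim (r∉NE (lose (hook-∈ p∈I) ne≡))
    where
      p∈I = proj₁ (ending-∈⁻ (subst (p ∈_) (sym eq) (here refl)))
      ne≡ = proj₂ (ending-∈⁻ (subst (p ∈_) (sym eq) (here refl)))
  ... | [] with firstHit π (hit r)
  ...   | just _ = refl
  ...   | nothing = refl

  -- The colour of a north-east endpoint r is that of the short hook ending
  -- at r: the long hook ending at r starts further left, so it has a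
  -- smaller colour.
  ne-colour : ∀ {r} → IsNE ℋ r → (color π ℋ r , (r ∸ 1 , r)) ∈ I
  ne-colour {r} r∈NE
    with ts , ts∈ ← colour-of (short-at r∈NE)
    with (t , h) , th∈ , refl ← ∈-map⁻ proj₁ (max-∈ (map proj₁ (ending r)) (∈-map⁺ proj₁ (ending-∈⁺ ts∈)))
    with th∈I , refl ← ending-∈⁻ th∈
    rewrite colour-on-NE r∈NE with long-or-short (hook-∈ th∈I)
  ... | inj₂ short = subst (λ x → (t , x) ∈ I) (×-≡,≡→≡ (short , refl)) th∈I
  ... | inj₁ long = ⊥-elim (<⇒≱ (colour-mono th∈I ts∈ (long-before-short (hook-∈ th∈I) long))
                      (max-upper (map proj₁ (ending (ne h))) (∈-map⁺ proj₁ (ending-∈⁺ ts∈))))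

  ColouredBy : Hook → ℕ → Set
  ColouredBy h r = ¬ IsNE ℋ r × Hits r h × (∀ {g} → g ∈ ℋ → Hits r g → ¬ HitBefore g h)

  coloured⇒ : ∀ {t h} → Long h → (t , h) ∈ I → ∀ {r} → color π ℋ r ≡ t → ColouredBy h r
  coloured⇒ {t} {h} long th∈ {r} col with any? (λ g → ne g ≟ r) ℋ
  ... | yes r∈NE = ⊥-elim (short-not-long (short-at r∈NE) (subst Long h≡short long))
    where h≡short = same-colour th∈ (subst (λ c → (c , _) ∈ I) col (ne-colour r∈NE))
  ... | no r∉NE with firstHit π (hit r) in fh
  ...   | nothing = ⊥-elim (<-irrefl 0≡t (colour-positive th∈))
    where 0≡t = trans (sym (hit-colour-nothing {r} fh)) (trans (sym (colour-off-NE r∉NE)) col)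
  ...   | just (t' , h')
    with c∈ , minimal ← firstHit-just (hit r) fh
    with th'∈ , hits' ← hit-∈⁻ {r} c∈
    with refl ← trans (sym (hit-colour-just {r} fh)) (trans (sym (colour-off-NE r∉NE)) col)
    with refl ← same-colour th'∈ th∈ =
    r∉NE , hits' , λ g∈ hits-g → minimal (hit-∈⁺ {r} (proj₂ (colour-of g∈)) hits-g)

  coloured⇐ : ∀ {t h} → (t , h) ∈ I → ∀ {r} → ColouredBy h r → color π ℋ r ≡ t
  coloured⇐ {t} {h} th∈ {r} (r∉NE , hits , first) with firstHit π (hit r) in fh
  ... | nothing with () ← subst ((t , h) ∈_) (firstHit-nothing (hit r) fh) (hit-∈⁺ {r} th∈ hits)
  ... | just (t' , h')
    with c∈ , minimal ← firstHit-just (hit r) fh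
    with th'∈ , hits' ← hit-∈⁻ {r} c∈
    with before-compare h h'
  ...   | inj₁ h<h' = ⊥-elim (minimal (hit-∈⁺ {r} th∈ hits) h<h')
  ...   | inj₂ (inj₁ h'<h) = ⊥-elim (first (hook-∈ th'∈) hits' h'<h)
  ...   | inj₂ (inj₂ (_ , sw≡)) with refl ← sw-injective (hook-∈ th∈) (hook-∈ th'∈) sw≡ =
    trans (colour-off-NE r∉NE) (trans (hit-colour-just {r} fh) (same-hook th'∈ th∈))

  ne-colours⇒ : ∀ {c} → c ∈ neColors π ℋ → ∃[ s ] ((c , s) ∈ I × ¬ Long s)
  ne-colours⇒ c∈ with r , r∈ , refl ← ∈-map⁻ (color π ℋ) c∈ =
    _ , ne-colour r∈NE , short-not-long (short-at r∈NE)
    where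
      r∈NE = Any.map (≡ᵇ⇒≡ _ _) (any⁻ _ ℋ (proj₂
               (∈-filter⁻ (λ r → T? (any (λ h → ne h ≡ᵇ r) ℋ)) {xs = range1 (length π)} r∈)))

  ne-colours⇐ : ∀ {t h} → (t , h) ∈ I → ¬ Long h → t ∈ neColors π ℋ
  ne-colours⇐ {t} {h} th∈ ¬long with long-or-short (hook-∈ th∈)
  ... | inj₁ long = ⊥-elim (¬long long)
  ... | inj₂ short = subst (_∈ neColors π ℋ) (same-hook colour-r th∈) (∈-map⁺ (color π ℋ) r∈)
    where
      h∈ = hook-∈ th∈
      r∈ : ne h ∈ filterᵇ (λ r → any (λ g → ne g ≡ᵇ r) ℋ) (range1 (length π))
      r∈ = ∈-filter⁺ (λ r → T? (any (λ g → ne g ≡ᵇ r) ℋ))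
             (range1-∈⁺ (proj₁ (ne-position h∈)) (proj₂ (ne-position h∈)))
             (any⁺ _ (lose h∈ (≡⇒≡ᵇ (ne h) (ne h) refl)))
      colour-r : (color π ℋ (ne h) , h) ∈ I
      colour-r = subst (λ s → (color π ℋ (ne h) , s) ∈ I) (sym (×-≡,≡→≡ (short , refl)))
                   (ne-colour (lose h∈ refl))

  longs : List (ℕ × Hook)
  longs = filter (λ p → descent? π (sw (proj₂ p))) I

  longs-∈⁻ : ∀ {t h} → (t , h) ∈ longs → (t , h) ∈ I × Long h
  longs-∈⁻ = ∈-filter⁻ (λ p → descent? π (sw (proj₂ p)))

  longs-∈⁺ : ∀ {t h} → (t , h) ∈ I → Long h → (t , h) ∈ longs
  longs-∈⁺ = ∈-filter⁺ (λ p → descent? π (sw (proj₂ p)))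

  longs-sorted : AllPairs (λ a b → proj₁ a < proj₁ b × sw (proj₂ a) < sw (proj₂ b)) longs
  longs-sorted = AllPairsP.filter⁺ _ I-sorted

  free? : ∀ t → Dec (T (not (any (λ c → c ≡ᵇ t) (neColors π ℋ))))
  free? t = T? (not (any (λ c → c ≡ᵇ t) (neColors π ℋ)))

  Θ≡ : Θ π ℋ ≡ 0 ∷ map proj₁ longs
  Θ≡ = sorted-unique (λ x<y y<x → <-asym x<y y<x)
         (AllPairsP.filter⁺ free? (upTo-sorted (suc (length ℋ))))
         (AllP.map⁺ (All.tabulate (λ p∈ → colour-positive (proj₁ (longs-∈⁻ p∈))))
           ∷ AllPairsP.map⁺ (AllPairs.map proj₁ longs-sorted))
         Θ⊆ ⊆Θ
    where
      in-Θ : ∀ {t} → t < suc (length ℋ) → ¬ t ∈ neColors π ℋ → t ∈ Θ π ℋ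
      in-Θ t< t∉ = ∈-filter⁺ free? (∈-upTo⁺ t<) (∉⇒not-any (neColors π ℋ) t∉)

      Θ⊆ : Θ π ℋ ⊆ 0 ∷ map proj₁ longs
      Θ⊆ {zero} _ = here refl
      Θ⊆ {suc i} t∈ with t∈upTo , not-ne ← ∈-filter⁻ free? {xs = upTo (suc (length ℋ))} t∈
                      with h , th∈ ← hook-of-colour (s≤s⁻¹ (∈-upTo⁻ t∈upTo))
                      with descent? π (sw h)
      ... | yes long = there (∈-map⁺ proj₁ (longs-∈⁺ th∈ long))
      ... | no ¬long = ⊥-elim (not-any⇒∉ (neColors π ℋ) not-ne (ne-colours⇐ th∈ ¬long))

      ⊆Θ : 0 ∷ map proj₁ longs ⊆ Θ π ℋ
      ⊆Θ (here refl) = in-Θ z<s λ 0∈ → let s , 0s∈ , _ = ne-colours⇒ 0∈ in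
                                         <-irrefl refl (colour-positive 0s∈)
      ⊆Θ (there t∈) with (t , h) , th∈ , refl ← ∈-map⁻ proj₁ t∈
                    with th∈I , long ← longs-∈⁻ th∈
                    with (i , i< , refl) , _ ← I-∈⁻ th∈I =
        in-Θ (s<s i<) λ t∈ne → let s , ts∈ , ¬long = ne-colours⇒ t∈ne in
                               ¬long (subst Long (same-colour th∈I ts∈) long)

  φ≡ : φ π ℋ ≡ q π ℋ 0 ∷ map (q π ℋ ∘ proj₁) longs
  φ≡ = trans (cong (map (q π ℋ)) Θ≡) (cong (q π ℋ 0 ∷_) (sym (ListP.map-∘ longs)))

  longs-sw≡descents : map (sw ∘ proj₂) longs ≡ descents π
  longs-sw≡descents = sorted-unique (λ x<y y<x → <-asym x<y y<x)
    (AllPairsP.map⁺ (AllPairs.map proj₂ longs-sorted)) (descents-sorted π) ⊆desc desc⊆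
    where
      ⊆desc : map (sw ∘ proj₂) longs ⊆ descents π
      ⊆desc d∈ with _ , th∈ , refl ← ∈-map⁻ (sw ∘ proj₂) d∈ = ∈-descents⁺ {π} (proj₂ (longs-∈⁻ th∈))
      desc⊆ : descents π ⊆ map (sw ∘ proj₂) longs
      desc⊆ d∈ with d-desc ← ∈-descents⁻ {π} d∈
               with h , h∈ , refl ← hook-at d-desc
               with t , th∈ ← colour-of h∈ = ∈-map⁺ (sw ∘ proj₂) (longs-∈⁺ th∈ d-desc)

module Comparison (π : List ℕ) (at-inj : AtInjective π) {ℋ₁ ℋ₂ : HookConfig}
                  (H₁ : InH02 π ℋ₁) (H₂ : InH02 π ℋ₂) where
  module C₁ = Coloring π at-inj H₁
  module C₂ = Coloring π at-inj H₂
  open HitOrder π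

  LongsRightOf : ℕ → Set
  LongsRightOf d = ∀ {h} → h ∈ ℋ₂ → C₂.Long h → d < sw h → h ∈ ℋ₁

  module _ {d j₁ j₂} (d-desc : IsDescent π d) (h₁∈ : (d , j₁) ∈ ℋ₁) (h₂∈ : (d , j₂) ∈ ℋ₂)
           (j₁<j₂ : j₁ < j₂) (agree : LongsRightOf d) where

    d<j₁ : d < j₁
    d<j₁ = proj₁ (proj₂ (C₁.hooks _ h₁∈))

    πj₁<πj₂ : at π j₁ < at π j₂
    πj₁<πj₂ = C₂.below-long h₂∈ d-desc d<j₁ j₁<j₂

    -- A point r ∈ (d, j₁] not above j₁ is no north-east endpoint of ℋ₂ unless
    -- a long hook of ℋ₁ right of d ends there: a long hook of ℋ₂ ending at r
    -- cannot start left of d (condition (d) against (d , j₂)), nor at d.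
    not-NE₂ : ∀ {r} → d < r → r ≤ j₁ → at π r ≤ at π j₁ →
              (∀ {g} → g ∈ ℋ₁ → C₁.Long g → d < sw g → ne g ≢ r) → ¬ IsNE ℋ₂ r
    not-NE₂ {r} d<r r≤j₁ πr≤πj₁ none r∈NE with g , g∈ , long , refl ← C₂.long-at r∈NE
                                         with <-cmp (sw g) d
    ... | tri< g<d _ _ = <⇒≱ g<d (proj₁ (C₂.condD g _ g∈ h₂∈ (≤-<-trans πr≤πj₁ πj₁<πj₂)
                           (overlap-two (<⇒≤ g<d) ≤-refl d<r (<-trans d<j₁ j₁<j₂))))
    ... | tri≈ _ g≡d _ = <-irrefl (cong ne (C₂.sw-injective g∈ h₂∈ g≡d)) (≤-<-trans r≤j₁ j₁<j₂)
    ... | tri> _ _ d<g = none (agree g∈ long d<g) long d<g refl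

    first₂ : ∀ {r} → d < r → r ≤ j₁ → ¬ IsNE ℋ₂ r →
             (∀ {h} → h ∈ ℋ₁ → C₁.Long h → d < sw h → Hits r h → at π j₁ < at π (ne h)) →
             ∀ {h} → h ∈ ℋ₂ → Hits r h → ¬ HitBefore h (d , j₂)
    first₂ {r} d<r r≤j₁ r∉NE high {h} h∈ hits@(sw<r , r≤ne , _) before with C₂.long-or-short h∈
    ... | inj₂ short = r∉NE (lose h∈ (sym (short-meets-end short sw<r r≤ne)))
    ... | inj₁ long with <-cmp (sw h) d
    ...   | tri≈ _ h≡d _ =
      before-irrefl _ (subst (λ x → HitBefore x _) (C₂.sw-injective h∈ h₂∈ h≡d) before)
    ...   | tri> _ _ d<h = <⇒≱ d<h (proj₁ (C₁.condD _ h h₁∈ h∈₁ (high h∈₁ long d<h hits)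
                             (overlap-two (<⇒≤ d<h) ≤-refl (<-≤-trans sw<r r≤j₁) sw<ne)))
      where
        h∈₁ = agree h∈ long d<h
        sw<ne = proj₁ (proj₂ (C₂.hooks _ h∈))
    ...   | tri< h<d _ _ with before
    ...     | inj₂ (_ , d<h) = <-asym h<d d<h
    ...     | inj₁ lower = <⇒≱ h<d (proj₁ (C₂.condD h _ h∈ h₂∈ lower
                             (overlap-two (<⇒≤ h<d) ≤-refl (<-≤-trans d<r r≤ne) (<-trans d<j₁ j₁<j₂))))

    coloured₁⇒coloured₂ : ∀ {r} → C₁.ColouredBy (d , j₁) r → C₂.ColouredBy (d , j₂) r
    coloured₁⇒coloured₂ {r} (r∉NE₁ , (d<r , r≤j₁ , πr<πj₁) , first₁) =
      r∉NE₂ , (d<r , ≤-trans r≤j₁ (<⇒≤ j₁<j₂) , <-trans πr<πj₁ πj₁<πj₂) , first₂ d<r r≤j₁ r∉NE₂ high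
      where
        r∉NE₂ : ¬ IsNE ℋ₂ r
        r∉NE₂ = not-NE₂ d<r r≤j₁ (<⇒≤ πr<πj₁) (λ g∈ _ _ g-ne → r∉NE₁ (lose g∈ g-ne))
        high : ∀ {h} → h ∈ ℋ₁ → C₁.Long h → d < sw h → Hits r h → at π j₁ < at π (ne h)
        high {h} h∈ _ d<h hits with <-cmp (at π j₁) (at π (ne h))
        ... | tri< πj₁<πh _ _ = πj₁<πh
        ... | tri> _ _ πh<πj₁ = ⊥-elim (first₁ h∈ hits (inj₁ πh<πj₁))
        ... | tri≈ _ πj₁≡πh _ = ⊥-elim (first₁ h∈ hits (inj₂ (sym πj₁≡πh , d<h)))

    j₁-coloured₂ : C₂.ColouredBy (d , j₂) j₁
    j₁-coloured₂ = j₁∉NE₂ , (d<j₁ , <⇒≤ j₁<j₂ , πj₁<πj₂) ,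
                   first₂ d<j₁ ≤-refl j₁∉NE₂ (λ _ _ _ → proj₂ ∘ proj₂)
      where
        j₁∉NE₂ : ¬ IsNE ℋ₂ j₁
        j₁∉NE₂ = not-NE₂ d<j₁ ≤-refl ≤-refl λ g∈ long d<g g-ne →
                   <-irrefl (sym (cong sw (C₁.long-ne-injective g∈ h₁∈ long d-desc g-ne))) d<g

    count-< : ∀ {t₁ t₂} → (t₁ , (d , j₁)) ∈ C₁.I → (t₂ , (d , j₂)) ∈ C₂.I → q π ℋ₁ t₁ < q π ℋ₂ t₂
    count-< {t₁} {t₂} th₁∈ th₂∈ =
      count-mono-< (λ r → T? (color π ℋ₁ r ≡ᵇ t₁)) (λ r → T? (color π ℋ₂ r ≡ᵇ t₂)) (range1 (length π))
        (λ _ col₁ → ≡⇒≡ᵇ _ _ (C₂.coloured⇐ th₂∈ (coloured₁⇒coloured₂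
                      (C₁.coloured⇒ d-desc th₁∈ (≡ᵇ⇒≡ _ _ col₁)))))
        (range1-∈⁺ (proj₁ (C₁.ne-position h₁∈)) (proj₂ (C₁.ne-position h₁∈)))
        (≡⇒≡ᵇ _ _ (C₂.coloured⇐ th₂∈ j₁-coloured₂))
        (λ col₁ → proj₁ (C₁.coloured⇒ d-desc th₁∈ (≡ᵇ⇒≡ _ _ col₁)) (lose h₁∈ refl))

module Matching (π : List ℕ) (at-inj : AtInjective π) {ℋ₁ ℋ₂ : HookConfig}
                (H₁ : InH02 π ℋ₁) (H₂ : InH02 π ℋ₂) (φ≡φ : φ π ℋ₁ ≡ φ π ℋ₂) where
  open Comparison π at-inj H₁ H₂

  SameAt : ℕ → Set
  SameAt d = ∀ {j₁ j₂} → (d , j₁) ∈ ℋ₁ → (d , j₂) ∈ ℋ₂ → j₁ ≡ j₂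

  SameRightOf : ℕ → Set
  SameRightOf d = ∀ {d'} → d < d' → IsDescent π d' → SameAt d'

  -- φ lists q₀ followed by the colour counts of the long hooks, ordered by
  -- their descents; so long hooks at the same descent have equal counts
  equal-counts : ∀ {d j₁ j₂ t₁ t₂} → IsDescent π d →
                 (t₁ , (d , j₁)) ∈ C₁.I → (t₂ , (d , j₂)) ∈ C₂.I → q π ℋ₁ t₁ ≡ q π ℋ₂ t₂
  equal-counts d-desc th₁∈ th₂∈ =
    matched-by-key (sw ∘ proj₂) (sw ∘ proj₂) (q π ℋ₁ ∘ proj₁) (q π ℋ₂ ∘ proj₁)
      (trans C₁.longs-sw≡descents (sym C₂.longs-sw≡descents))
      (proj₂ (∷-injective (trans (sym C₁.φ≡) (trans φ≡φ C₂.φ≡))))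
      (AllPairs.map (λ (_ , sw<) → <⇒≢ sw<) C₁.longs-sorted)
      (C₁.longs-∈⁺ th₁∈ d-desc) (C₂.longs-∈⁺ th₂∈ d-desc) refl

  agreement : ∀ {d} → SameRightOf d → LongsRightOf d
  agreement same {d' , j} h∈ long d<d' with (_ , j') , g∈ , refl ← C₁.hook-at long =
    subst (λ x → (d' , x) ∈ ℋ₁) (same d<d' long g∈ h∈) g∈

  not-shorter : ∀ {d j₁ j₂} → SameRightOf d → IsDescent π d →
                (d , j₁) ∈ ℋ₁ → (d , j₂) ∈ ℋ₂ → ¬ j₁ < j₂
  not-shorter same d-desc h₁∈ h₂∈ j₁<j₂ with t₁ , th₁∈ ← C₁.colour-of h₁∈
                                        with t₂ , th₂∈ ← C₂.colour-of h₂∈ =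
    <-irrefl (equal-counts d-desc th₁∈ th₂∈) (count-< d-desc h₁∈ h₂∈ j₁<j₂ (agreement same) th₁∈ th₂∈)

  -- once the hooks agree at every descent, every hook of ℋ₁ is one of ℋ₂:
  -- long hooks directly, short ones as the short hook ending with a long one
  long-included : (∀ {d} → IsDescent π d → SameAt d) → ∀ {h} → h ∈ ℋ₁ → C₁.Long h → h ∈ ℋ₂
  long-included same {d , j} h∈ long with (_ , j') , g∈ , refl ← C₂.hook-at long =
    subst (λ x → (d , x) ∈ ℋ₂) (sym (same long h∈ g∈)) g∈

  included : (∀ {d} → IsDescent π d → SameAt d) → ∀ {h} → h ∈ ℋ₁ → h ∈ ℋ₂
  included same h∈ with C₁.long-or-short h∈
  ... | inj₁ long = long-included same h∈ long
  ... | inj₂ short with g , g∈ , long , g-ne ← C₁.long-at (lose h∈ refl) =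
    subst (_∈ ℋ₂) (sym (×-≡,≡→≡ (short , refl)))
      (C₂.short-at (lose (long-included same g∈ long) g-ne))

-- The hooks of two configurations with equal φ agree at every descent, by
-- induction from the right: at the rightmost disagreement, the configuration
-- with the shorter hook contradicts `not-shorter`, applied in one direction
-- or the other.
module Agreement (π : List ℕ) (at-inj : AtInjective π) {ℋ₁ ℋ₂ : HookConfig}
                 (H₁ : InH02 π ℋ₁) (H₂ : InH02 π ℋ₂) (φ≡φ : φ π ℋ₁ ≡ φ π ℋ₂) where
  module M₁₂ = Matching π at-inj H₁ H₂ φ≡φ
  module M₂₁ = Matching π at-inj H₂ H₁ (sym φ≡φ)

  step : ∀ {d} → M₁₂.SameRightOf d → IsDescent π d → M₁₂.SameAt d
  step {d} right d-desc {j₁} {j₂} h₁∈ h₂∈ with <-cmp j₁ j₂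
  ... | tri≈ _ j₁≡j₂ _ = j₁≡j₂
  ... | tri< j₁<j₂ _ _ = ⊥-elim (M₁₂.not-shorter right d-desc h₁∈ h₂∈ j₁<j₂)
  ... | tri> _ _ j₂<j₁ = ⊥-elim (M₂₁.not-shorter right' d-desc h₂∈ h₁∈ j₂<j₁)
    where
      right' : M₂₁.SameRightOf d
      right' d<d' d'-desc h₂∈' h₁∈' = sym (right d<d' d'-desc h₁∈' h₂∈')

  same-within : ∀ k {d} → length π ∸ d ≤ k → IsDescent π d → M₁₂.SameAt d
  same-within zero bound (_ , d<n , _) = ⊥-elim (<⇒≱ (m<n⇒0<n∸m d<n) bound)
  same-within (suc k) {d} bound = step λ {d'} d<d' → same-within k (closer d<d')
    where
      closer : ∀ {d'} → d < d' → length π ∸ d' ≤ k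
      closer d<d' = ≤-trans (∸-monoʳ-≤ (length π) d<d')
                      (subst (_≤ k) (pred[m∸n]≡m∸[1+n] (length π) d) (pred-mono-≤ bound))

  same : ∀ {d} → IsDescent π d → M₁₂.SameAt d
  same {d} = same-within (length π ∸ d) ≤-refl

  same⁻¹ : ∀ {d} → IsDescent π d → M₂₁.SameAt d
  same⁻¹ d-desc h₂∈ h₁∈ = sym (same d-desc h₁∈ h₂∈)

lemma4 : (n k : ℕ) (π : List ℕ) → IsPerm n π → length (descents π) ≡ k →
         (ℋ₁ ℋ₂ : HookConfig) → InH02 π ℋ₁ → InH02 π ℋ₂ →
         φ π ℋ₁ ≡ φ π ℋ₂ → ℋ₁ ≡ ℋ₂
lemma4 n k π π∈Sₙ _ ℋ₁ ℋ₂ H₁ H₂ φ≡φ =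
  sorted-unique (λ sw< sw> → <-asym sw< sw>)
    (Configuration.sw-sorted π at-inj H₁) (Configuration.sw-sorted π at-inj H₂)
    (M₁₂.included same) (M₂₁.included same⁻¹)
  where
    at-inj : AtInjective π
    at-inj = perm⇒at-injective π∈Sₙ
    open Agreement π at-inj H₁ H₂ φ≡φ
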